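{- Let $R$ be a ring, $b\in R$, and let $\mathbf B=\begin{pmatrix}1&1&-1\\0&b&0\\0&0&b\end{pmatrix}$. (1) $\mathbf B$ is partition regular over $R$ if and only if $\mathrm{ann}(b)=\{x\in R: xb=0\}$ is infinite. (2) $\mathbf B$ satisfies the generalised columns condition over $R$ if and only if there exists $d\in R$ with $db=0$ such that $d^nR$ is infinite for all $n\ge0$.
   Context: Rings are commutative with unit. A $k\times l$ matrix $\mathbf A$ over $R$ is partition regular over $R$ if for every integer $r\ge1$ and every map $\chi\colon R\to\{1,\dots,r\}$ there is $\mathbf x=(x_1,\dots,x_l)^\intercal\in R^l$, $\mathbf x\ne0$, with $\mathbf A\mathbf x=0$ and $\chi(x_1)=\dots=\chi(x_l)$. Generalised columns condition: with columns $\mathbf c_1,\dots,\mathbf c_l$ of $\mathbf A$, there exist $m\ge0$, a partition $\{1,\dots,l\}=I_0\cup\dots\cup I_m$ and $d_0,\dots,d_m\in R\setminus\{0\}$ with (i) $d_0\sum_{i\in I_0}\mathbf c_i=0$; (ii) for $t=1,\dots,m$, $d_t\sum_{i\in I_t}\mathbf c_i$ lies in the $R$-submodule of $R^k$ generated by the $\mathbf c_j$, $j\in I_0\cup\dots\cup I_{t-1}$; (iii) if $m>0$, the ideal $d_0(d_1\cdots d_m)^nR$ is infinite for all $n\ge0$. -}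

module Defs where

open import Level using (Level; _⊔_) renaming (suc to lsuc)
open import Algebra.Bundles using (CommutativeRing)
open import Data.Nat as ℕ using (ℕ; zero; suc; _<_)
open import Data.Fin as Fin using (Fin; zero; suc; toℕ)
open import Data.Fin.Properties using () renaming (_≟_ to _≟ᶠ_)
open import Data.List using (List)
open import Data.List.Relation.Unary.Any using (Any)
open import Data.Product using (Σ; ∃; _×_; _,_)
open import Relation.Binary.PropositionalEquality using (_≡_)
open import Relation.Nullary using (¬_; yes; no)
open import Relation.Nullary.Decidable using (Dec)

module RingDefs {c ℓ : Level} (R : CommutativeRing c ℓ) where
  open CommutativeRing R using (Carrier; _≈_; _+_; _*_; -_; 0#; 1#)

  sumᶠ : ∀ {n} → (Fin n → Carrier) → Carrier
  sumᶠ {zero}  v = 0#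
  sumᶠ {suc n} v = v zero + sumᶠ (λ j → v (suc j))

  pow : Carrier → ℕ → Carrier
  pow a zero    = 1#
  pow a (suc n) = a * pow a n

  Finite : (Carrier → Set (c ⊔ ℓ)) → Set (c ⊔ ℓ)
  Finite S = Σ (List Carrier) λ xs → ∀ y → S y → Any (y ≈_) xs

  Infinite : (Carrier → Set (c ⊔ ℓ)) → Set (c ⊔ ℓ)
  Infinite S = ¬ Finite S

  ann : Carrier → Carrier → Set (c ⊔ ℓ)
  ann b x = Level.Lift c (x * b ≈ 0#)

  principalIdeal : Carrier → Carrier → Set (c ⊔ ℓ)
  principalIdeal a y = Σ Carrier λ z → y ≈ a * z

  Matrix : ℕ → ℕ → Set c
  Matrix k l = Fin k → Fin l → Carrier

  Solves : ∀ {k l} → Matrix k l → (Fin l → Carrier) → Set ℓ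
  Solves A x = ∀ i → sumᶠ (λ j → A i j * x j) ≈ 0#

  NonZeroVec : ∀ {l} → (Fin l → Carrier) → Set ℓ
  NonZeroVec x = ¬ (∀ j → x j ≈ 0#)

  PartitionRegular : ∀ {k l} → Matrix k l → Set (c ⊔ ℓ)
  PartitionRegular {k} {l} A =
    (r : ℕ) → 1 ℕ.≤ r → (χ : Carrier → Fin r) →
    (∀ {u v} → u ≈ v → χ u ≡ χ v) →
    Σ (Fin l → Carrier) λ x →
      NonZeroVec x × Solves A x × (∀ i j → χ (x i) ≡ χ (x j))

  when : {P : Set} → Dec P → Carrier → Carrier
  when (yes _) a = a
  when (no  _) a = 0#

  -- generalised columns condition; the partition I_0 ∪ … ∪ I_m of the
  -- column indices is given by p : Fin l → Fin (suc m), I_t = p⁻¹(t),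
  -- each block nonempty.
  GCC : ∀ {k l} → Matrix k l → Set (c ⊔ ℓ)
  GCC {k} {l} A =
    Σ ℕ λ m →
    Σ (Fin l → Fin (suc m)) λ p →
    Σ (Fin (suc m) → Carrier) λ d →
      (∀ t → Σ (Fin l) λ j → p j ≡ t) ×
      (∀ t → ¬ (d t ≈ 0#)) ×
      (∀ i → d zero * sumᶠ (λ j → when (p j ≟ᶠ zero) (A i j)) ≈ 0#) ×
      -- (ii) d_t Σ_{i ∈ I_t} c_i ∈ span { c_j : j ∈ I_0 ∪ … ∪ I_{t-1} }
      (∀ (t : Fin (suc m)) → 0 < toℕ t →
         Σ (Fin l → Carrier) λ λs → ∀ i →
           d t * sumᶠ (λ j → when (p j ≟ᶠ t) (A i j))
             ≈ sumᶠ (λ j → when (toℕ (p j) ℕ.<? toℕ t) (λs j * A i j))) ×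
      (0 < m → ∀ (n : ℕ) →
         Infinite (principalIdeal (d zero * pow (prodTail d) n)))
    where
      prodTail : ∀ {m} → (Fin (suc m) → Carrier) → Carrier
      prodTail {m} d = prodᶠ (λ (t : Fin m) → d (suc t))
        where
          prodᶠ : ∀ {n} → (Fin n → Carrier) → Carrier
          prodᶠ {zero}  v = 1#
          prodᶠ {suc n} v = v zero * prodᶠ (λ j → v (suc j))

  matB : Carrier → Matrix 3 3
  matB b zero             zero             = 1#
  matB b zero             (suc zero)       = 1#
  matB b zero             (suc (suc zero)) = - 1#
  matB b (suc zero)       (suc zero)       = b
  matB b (suc (suc zero)) (suc (suc zero)) = b
  matB b _                _                = 0#

module Submission where

-- B x = 0 means x₀ + x₁ = x₂ with x₁, x₂ ∈ ann(b) (solves-B).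
-- (1 ⇐) An infinite Ramsey theorem (ramsey-triangle, module Classical):
--   any finite colouring χ of an infinite S ⊆ R has u, v ≠ u, w ∈ S with
--   χ(v − u) = χ(w − u) = χ(w − v); for S = ann(b), (w − v, v − u, w − u)
--   is a monochromatic nonzero solution.
-- (1 ⇒) Colouring by position in a list of ann(b) separates its elements,
--   so a monochromatic solution has x_j = x₁ = x₁ + x₁ = 0.
-- (2 ⇐) Take I₀ = {1,2}, I₁ = {0} and d₀ = d₁ = d.
-- (2 ⇒) Row 0 of (i) forces I₀ to omit exactly one column j, since a
--   nonzero d₀ annihilates neither 1 nor −1; so I₁ = {j} is the only other
--   block, (ii) yields d₁ b = 0 and (iii) that d₁^n R ⊇ d₀ d₁^n R is infinite.

open import Defs
open import Level using (Level; _⊔_; Lift; lift; lower)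
open import Algebra.Bundles using (CommutativeRing)
open import Axiom.ExcludedMiddle using (ExcludedMiddle)
open import Data.Nat as ℕ using (ℕ; zero; suc; s≤s; z≤n)
open import Data.Nat.Properties using (≤-refl; ≤-trans; ≤-pred; n≮0)
open import Data.Fin using (Fin; zero; suc; toℕ)
open import Data.Fin.Properties using (0≢1+n; suc-injective) renaming (_≟_ to _≟ᶠ_)
open import Data.List using (List; []; _∷_; _++_; length; filter; allFin)
open import Data.List.Properties using (filter-notAll)
open import Data.List.Relation.Unary.Any using (Any; here; there)
import Data.List.Relation.Unary.Any as Any
open import Data.List.Relation.Unary.Any.Properties using (++⁺ˡ; ++⁺ʳ)
open import Data.List.Membership.Propositional using (_∈_)
open import Data.List.Membership.Propositional.Properties using (∈-filter⁺; ∈-allFin)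
open import Data.Product using (Σ; _×_; _,_; proj₁; proj₂)
open import Data.Empty using (⊥-elim)
open import Function.Base using (_∘_)
open import Function.Bundles using (_⇔_; mk⇔; Equivalence)
open import Relation.Nullary using (¬_; Dec; yes; no; ¬?)
open import Relation.Nullary.Decidable using (map′)
open import Relation.Binary.PropositionalEquality as P using (_≡_; _≢_)

module Basics {c ℓ : Level} (R : CommutativeRing c ℓ) where
  open CommutativeRing R hiding (zero) renaming (Carrier to A)
  open RingDefs R
  open import Algebra.Properties.Ring ring public
    using (-1*x≈-x; x+x≈x⇒x≈0; [y-z]x≈yx-zx; -‿involutive;
           \\-leftDividesʳ; x∙y⁻¹≈ε⇒x≈y; x≈y⇒x∙y⁻¹≈ε)
  open import Relation.Binary.Reasoning.Setoid setoid

  Subset : Set (Level.suc (c ⊔ ℓ))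
  Subset = A → Set (c ⊔ ℓ)

  telescope : ∀ u v w → (w - v) + (v - u) ≈ w - u
  telescope u v w = begin
    (w - v) + (v - u)     ≈⟨ +-assoc w (- v) (v - u) ⟩
    w + (- v + (v - u))   ≈⟨ +-congˡ (\\-leftDividesʳ v (- u)) ⟩
    w - u                 ∎

  difference-annihilated : ∀ {b u v} → u * b ≈ 0# → v * b ≈ 0# → (v - u) * b ≈ 0#
  difference-annihilated {b} {u} {v} ub vb =
    trans ([y-z]x≈yx-zx b v u) (x≈y⇒x∙y⁻¹≈ε (trans vb (sym ub)))

  unit-cancel : ∀ {d s s'} → d * s ≈ 0# → s' * s ≈ 1# → d ≈ 0#
  unit-cancel {d} {s} {s'} ds≈0 s's≈1 = begin
    d              ≈⟨ *-identityʳ d ⟨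
    d * 1#         ≈⟨ *-congˡ (trans (*-comm s s') s's≈1) ⟨
    d * (s * s')   ≈⟨ *-assoc d s s' ⟨
    (d * s) * s'   ≈⟨ *-congʳ ds≈0 ⟩
    0# * s'        ≈⟨ zeroˡ s' ⟩
    0#             ∎

  annihilates-one : ∀ {d s} → d * s ≈ 0# → s ≈ 1# → d ≈ 0#
  annihilates-one {s = s} ds≈0 s≈1 = unit-cancel ds≈0 (trans (*-identityˡ s) s≈1)

  annihilates-minus-one : ∀ {d s} → d * s ≈ 0# → s ≈ - 1# → d ≈ 0#
  annihilates-minus-one {s = s} ds≈0 s≈-1 =
    unit-cancel ds≈0 (trans (-1*x≈-x s) (trans (-‿cong s≈-1) (-‿involutive 1#)))

  -- Three-term sums x + (y + (z + 0)), i.e. sums over Fin 3, in which two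
  -- of the terms vanish.
  only-first : ∀ {x y z} → y ≈ 0# → z ≈ 0# → x + (y + (z + 0#)) ≈ x
  only-first {x} y≈0 z≈0 =
    trans (+-congˡ (trans (+-cong y≈0 (trans (+-identityʳ _) z≈0)) (+-identityʳ 0#)))
          (+-identityʳ x)

  only-second : ∀ {x y z} → x ≈ 0# → z ≈ 0# → x + (y + (z + 0#)) ≈ y
  only-second {x} {y} x≈0 z≈0 =
    trans (+-cong x≈0 (trans (+-congˡ (trans (+-identityʳ _) z≈0)) (+-identityʳ y)))
          (+-identityˡ y)

  only-third : ∀ {x y z} → x ≈ 0# → y ≈ 0# → x + (y + (z + 0#)) ≈ z
  only-third {x} {y} {z} x≈0 y≈0 =
    trans (+-cong x≈0 (trans (+-cong y≈0 (+-identityʳ z)) (+-identityˡ z))) (+-identityˡ z)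

  all-vanish : ∀ {x y z} → x ≈ 0# → y ≈ 0# → z ≈ 0# → x + (y + (z + 0#)) ≈ 0#
  all-vanish x≈0 y≈0 z≈0 = trans (only-first y≈0 z≈0) x≈0

  sumᶠ-cong : ∀ {n} {u v : Fin n → A} → (∀ j → u j ≈ v j) → sumᶠ u ≈ sumᶠ v
  sumᶠ-cong {zero}  u≈v = refl
  sumᶠ-cong {suc n} u≈v = +-cong (u≈v zero) (sumᶠ-cong (u≈v ∘ suc))

  sum-when-reindex : ∀ {n} {B : Set} {Q : B → Set} (Q? : ∀ k → Dec (Q k))
    {f g : Fin n → B} → (∀ j → f j ≡ g j) → (a : Fin n → A) →
    sumᶠ (λ j → when (Q? (f j)) (a j)) ≈ sumᶠ (λ j → when (Q? (g j)) (a j))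
  sum-when-reindex Q? f≗g a =
    sumᶠ-cong (λ j → reflexive (P.cong (λ k → when (Q? k) (a j)) (f≗g j)))

  pow-cong : ∀ {x y} → x ≈ y → ∀ n → pow x n ≈ pow y n
  pow-cong x≈y zero    = refl
  pow-cong x≈y (suc n) = *-cong x≈y (pow-cong x≈y n)

  ideal-resp : ∀ {a a' y} → a ≈ a' → principalIdeal a y → principalIdeal a' y
  ideal-resp a≈a' (z , y≈az) = z , trans y≈az (*-congʳ a≈a')

  ideal-⊆-multiple : ∀ {a e y} → principalIdeal (a * e) y → principalIdeal a y
  ideal-⊆-multiple {a} {e} (z , y≈aez) = e * z , trans y≈aez (*-assoc a e z)

  zero-ideal-finite : ∀ {a} → a ≈ 0# → Finite (principalIdeal a)
  zero-ideal-finite {a} a≈0 =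
    0# ∷ [] , λ y (z , y≈az) → here (trans y≈az (trans (*-congʳ a≈0) (zeroˡ z)))

  infinite-⊇ : {S T : Subset} → (∀ {y} → S y → T y) → Infinite S → Infinite T
  infinite-⊇ S⊆T S-inf (xs , T-listed) = S-inf (xs , λ y → T-listed y ∘ S⊆T)

  finite-⋃ : ∀ r (T : Fin r → Subset) → (∀ k → Finite (T k)) →
             Finite (λ y → Σ (Fin r) λ k → T k y)
  finite-⋃ zero    T T-fin = [] , λ { y (() , _) }
  finite-⋃ (suc r) T T-fin with T-fin zero | finite-⋃ r (T ∘ suc) (T-fin ∘ suc)
  ... | xs , xs-lists | ys , ys-lists =
    xs ++ ys , λ { y (zero , t) → ++⁺ˡ (xs-lists y t)
                 ; y (suc k , t) → ++⁺ʳ xs (ys-lists y (k , t)) }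

module Classical {c ℓ : Level} (R : CommutativeRing c ℓ)
                 (lem : ExcludedMiddle (c ⊔ ℓ)) where
  open CommutativeRing R hiding (zero) renaming (Carrier to A)
  open RingDefs R
  open Basics R

  decide : (Q : Set ℓ) → Dec Q
  decide Q = map′ lower lift (lem {Lift c Q})

  inhabited : (S : Subset) → Infinite S → Σ A S
  inhabited S S-inf with lem {Σ A S}
  ... | yes s  = s
  ... | no ¬s  = ⊥-elim (S-inf ([] , λ y Sy → ⊥-elim (¬s (y , Sy))))

  _∖_ : Subset → A → Subset
  (S ∖ u) y = S y × ¬ y ≈ u

  infinite-∖ : ∀ S u → Infinite S → Infinite (S ∖ u)
  infinite-∖ S u S-inf (xs , listed) = S-inf (u ∷ xs , listed′)
    where
    listed′ : ∀ y → S y → Any (y ≈_) (u ∷ xs)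
    listed′ y Sy with decide (y ≈ u)
    ... | yes y≈u = here y≈u
    ... | no  y≉u = there (listed y (Sy , y≉u))

  Fibre : ∀ {r} → Subset → (A → Fin r) → Fin r → Subset
  Fibre S f k y = S y × f y ≡ k

  pigeonhole : ∀ {r} (S : Subset) (f : A → Fin r) → Infinite S →
               Σ (Fin r) λ k → Infinite (Fibre S f k)
  pigeonhole {r} S f S-inf with lem {Σ (Fin r) λ k → Infinite (Fibre S f k)}
  ... | yes fibre = fibre
  ... | no ¬fibre =
    ⊥-elim (infinite-⊇ (λ {y} Sy → f y , Sy , P.refl) S-inf
                       (finite-⋃ r (Fibre S f) fibre-finite))
    where
    fibre-finite : ∀ k → Finite (Fibre S f k)
    fibre-finite k with lem {Finite (Fibre S f k)}
    ... | yes fin  = fin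
    ... | no ¬fin  = ⊥-elim (¬fibre (k , ¬fin))

  record MonoTriangle {r} (χ : A → Fin r) (S : Subset) : Set (c ⊔ ℓ) where
    field
      u v w     : A
      u∈S       : S u
      v∈S       : S v
      w∈S       : S w
      v≉u       : ¬ v ≈ u
      colour-wu : χ (w - u) ≡ χ (v - u)
      colour-wv : χ (w - v) ≡ χ (v - u)

  triangle-mono : ∀ {r} {χ : A → Fin r} {S T : Subset} →
                  (∀ {y} → S y → T y) → MonoTriangle χ S → MonoTriangle χ T
  triangle-mono S⊆T t = record
    { u = u ; v = v ; w = w ; u∈S = S⊆T u∈S ; v∈S = S⊆T v∈S ; w∈S = S⊆T w∈S
    ; v≉u = v≉u ; colour-wu = colour-wu ; colour-wv = colour-wv }
    where open MonoTriangle t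

  module _ {r} (χ : A → Fin r) where

    DifferenceColours : Subset → List (Fin r) → Set (c ⊔ ℓ)
    DifferenceColours S cs = ∀ {v w} → S v → S w → ¬ w ≈ v → χ (w - v) ∈ cs

    Neighbourhood : Subset → A → Fin r → Subset
    Neighbourhood S u k = Fibre (S ∖ u) (λ y → χ (y - u)) k

    ClosingPair : Subset → A → Fin r → Set (c ⊔ ℓ)
    ClosingPair S u k = Σ A λ v → Σ A λ w →
      Neighbourhood S u k v × Neighbourhood S u k w × ¬ w ≈ v × χ (w - v) ≡ k

    close : ∀ {S u k} → S u → ClosingPair S u k → MonoTriangle χ S
    close {u = u} Su (v , w , ((Sv , v≉u) , χv) , ((Sw , _) , χw) , _ , χwv) = record
      { u = u ; v = v ; w = w ; u∈S = Su ; v∈S = Sv ; w∈S = Sw ; v≉u = v≉u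
      ; colour-wu = P.trans χw (P.sym χv) ; colour-wv = P.trans χwv (P.sym χv) }

    -- Induction on the number of colours available for differences: pick
    -- u ∈ S and an infinite neighbourhood N of u of colour k.  Either N
    -- contains a closing pair, or colour k does not occur inside N and we
    -- recurse into N with fewer colours.
    triangle-bounded : ∀ n (cs : List (Fin r)) → length cs ℕ.≤ n → (S : Subset) →
                       Infinite S → DifferenceColours S cs → MonoTriangle χ S
    triangle-bounded n cs len S S-inf S-colours with inhabited S S-inf
    ... | u , Su with pigeonhole (S ∖ u) (λ y → χ (y - u)) (infinite-∖ S u S-inf)
    ... | k , N-inf with lem {ClosingPair S u k}
    ... | yes pair = close Su pair
    ... | no ¬pair = triangle-mono (proj₁ ∘ proj₁) (recurse n len)
      where
      N : Subset
      N = Neighbourhood S u k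

      avoid-k : ∀ k' → Dec (¬ k' ≡ k)
      avoid-k k' = ¬? (k' ≟ᶠ k)

      -- k is the colour of v − u for every v ∈ N, so it is one of cs
      k∈cs : k ∈ cs
      k∈cs with inhabited N N-inf
      ... | v , (Sv , v≉u) , χv = P.subst (_∈ cs) χv (S-colours Su Sv v≉u)

      N-colours : DifferenceColours N (filter avoid-k cs)
      N-colours {v} {w} Nv Nw w≉v =
        ∈-filter⁺ avoid-k (S-colours (proj₁ (proj₁ Nv)) (proj₁ (proj₁ Nw)) w≉v)
                          (λ χwv → ¬pair (v , w , Nv , Nw , w≉v , χwv))

      fewer : length (filter avoid-k cs) ℕ.< length cs
      fewer = filter-notAll avoid-k cs (Any.map (λ k≡k' ¬k'≡k → ¬k'≡k (P.sym k≡k')) k∈cs)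

      recurse : ∀ n → length cs ℕ.≤ n → MonoTriangle χ N
      recurse zero    len = ⊥-elim (n≮0 (≤-trans fewer len))
      recurse (suc n) len =
        triangle-bounded n (filter avoid-k cs) (≤-pred (≤-trans fewer len)) N N-inf N-colours

    ramsey-triangle : ∀ {S} → Infinite S → MonoTriangle χ S
    ramsey-triangle {S} S-inf =
      triangle-bounded _ (allFin r) ≤-refl S S-inf (λ _ _ _ → ∈-allFin _)

  position : (xs : List A) → A → Fin (suc (length xs))
  position []       y = zero
  position (x ∷ xs) y with decide (y ≈ x)
  ... | yes _ = zero
  ... | no  _ = suc (position xs y)

  position-cong : ∀ xs {u v} → u ≈ v → position xs u ≡ position xs v
  position-cong []       u≈v = P.refl
  position-cong (x ∷ xs) {u} {v} u≈v with decide (u ≈ x) | decide (v ≈ x)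
  ... | yes _   | yes _   = P.refl
  ... | yes u≈x | no  v≉x = ⊥-elim (v≉x (trans (sym u≈v) u≈x))
  ... | no  u≉x | yes v≈x = ⊥-elim (u≉x (trans u≈v v≈x))
  ... | no  _   | no  _   = P.cong suc (position-cong xs u≈v)

  position-separates : ∀ xs {y z} → Any (y ≈_) xs → position xs y ≡ position xs z → y ≈ z
  position-separates (x ∷ xs) {y} {z} y∈xs same with decide (y ≈ x) | decide (z ≈ x)
  ... | yes y≈x | yes z≈x = trans y≈x (sym z≈x)
  ... | yes _   | no  _   = ⊥-elim (0≢1+n same)
  ... | no  _   | yes _   = ⊥-elim (0≢1+n (P.sym same))
  ... | no  y≉x | no  _   with y∈xs
  ...   | here  y≈x  = ⊥-elim (y≉x y≈x)
  ...   | there y∈xs′ = position-separates xs y∈xs′ (suc-injective same)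

module MatrixB {c ℓ : Level} (R : CommutativeRing c ℓ) (b : CommutativeRing.Carrier R) where
  open CommutativeRing R hiding (zero) renaming (Carrier to A)
  open RingDefs R
  open Basics R
  open import Relation.Binary.Reasoning.Setoid setoid

  BSolution : (Fin 3 → A) → Set ℓ
  BSolution x = (x zero + x (suc zero) ≈ x (suc (suc zero)))
              × (x (suc zero) * b ≈ 0#) × (x (suc (suc zero)) * b ≈ 0#)

  row₀ : (x : Fin 3 → A) → sumᶠ (λ j → matB b zero j * x j)
               ≈ (x zero + x (suc zero)) - x (suc (suc zero))
  row₀ x = begin
    1# * x₀ + (1# * x₁ + (- 1# * x₂ + 0#))
      ≈⟨ +-cong (*-identityˡ x₀) (+-cong (*-identityˡ x₁)
                (trans (+-identityʳ (- 1# * x₂)) (-1*x≈-x x₂))) ⟩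
    x₀ + (x₁ - x₂)   ≈⟨ +-assoc x₀ x₁ (- x₂) ⟨
    (x₀ + x₁) - x₂   ∎
    where
    x₀ x₁ x₂ : A
    x₀ = x zero
    x₁ = x (suc zero)
    x₂ = x (suc (suc zero))

  row₁ : (x : Fin 3 → A) → sumᶠ (λ j → matB b (suc zero) j * x j) ≈ x (suc zero) * b
  row₁ x = trans (only-second (zeroˡ (x zero)) (zeroˡ (x (suc (suc zero)))))
                 (*-comm b (x (suc zero)))

  row₂ : (x : Fin 3 → A) → sumᶠ (λ j → matB b (suc (suc zero)) j * x j) ≈ x (suc (suc zero)) * b
  row₂ x = trans (only-third (zeroˡ (x zero)) (zeroˡ (x (suc zero))))
                 (*-comm b (x (suc (suc zero))))

  solves-B : ∀ x → Solves (matB b) x ⇔ BSolution x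
  solves-B x = mk⇔ to from
    where
    to : Solves (matB b) x → BSolution x
    to sol = x∙y⁻¹≈ε⇒x≈y _ _ (trans (sym (row₀ x)) (sol zero))
           , trans (sym (row₁ x)) (sol (suc zero))
           , trans (sym (row₂ x)) (sol (suc (suc zero)))
    from : BSolution x → Solves (matB b) x
    from (sum≈ , _ , _) zero             = trans (row₀ x) (x≈y⇒x∙y⁻¹≈ε sum≈)
    from (_ , x₁b≈0 , _) (suc zero)       = trans (row₁ x) x₁b≈0
    from (_ , _ , x₂b≈0) (suc (suc zero)) = trans (row₂ x) x₂b≈0

module PartitionRegularity {c ℓ : Level} (R : CommutativeRing c ℓ)
                           (lem : ExcludedMiddle (c ⊔ ℓ)) (b : CommutativeRing.Carrier R) where
  open CommutativeRing R hiding (zero) renaming (Carrier to A)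
  open RingDefs R
  open Basics R
  open Classical R lem
  open MatrixB R b

  triangle-solution : ∀ {r} {χ : A → Fin r} → MonoTriangle χ (ann b) →
    Σ (Fin 3 → A) λ x → NonZeroVec x × Solves (matB b) x × (∀ i j → χ (x i) ≡ χ (x j))
  triangle-solution {χ = χ} t = x , x≢0 , Equivalence.from (solves-B x) solution , mono
    where
    open MonoTriangle t
    x : Fin 3 → A
    x zero             = w - v
    x (suc zero)       = v - u
    x (suc (suc zero)) = w - u
    x≢0 : NonZeroVec x
    x≢0 x≈0 = v≉u (x∙y⁻¹≈ε⇒x≈y v u (x≈0 (suc zero)))
    solution : BSolution x
    solution = telescope u v w
             , difference-annihilated (lower u∈S) (lower v∈S)
             , difference-annihilated (lower u∈S) (lower w∈S)
    colour : ∀ i → χ (x i) ≡ χ (v - u)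
    colour zero             = colour-wv
    colour (suc zero)       = P.refl
    colour (suc (suc zero)) = colour-wu
    mono : ∀ i j → χ (x i) ≡ χ (x j)
    mono i j = P.trans (colour i) (P.sym (colour j))

  infinite⇒regular : Infinite (ann b) → PartitionRegular (matB b)
  infinite⇒regular ann-inf r _ χ _ = triangle-solution (ramsey-triangle χ ann-inf)

  -- If ann(b) ⊆ xs, colour by position in xs: a monochromatic solution has
  -- x₁ ∈ ann(b) coloured like every x_j, so x_j = x₁ = x₁ + x₁ = 0.
  regular⇒infinite : PartitionRegular (matB b) → Infinite (ann b)
  regular⇒infinite regular (xs , listed)
    with regular (suc (length xs)) (s≤s z≤n) (position xs) (position-cong xs)
  ... | x , x≢0 , sol , mono = x≢0 x≈0
    where
    x₁ : A
    x₁ = x (suc zero)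
    x₀+x₁≈x₂ : x zero + x₁ ≈ x (suc (suc zero))
    x₀+x₁≈x₂ = proj₁ (Equivalence.to (solves-B x) sol)
    x₁∈ann : x₁ * b ≈ 0#
    x₁∈ann = proj₁ (proj₂ (Equivalence.to (solves-B x) sol))
    x₁≈ : ∀ j → x₁ ≈ x j
    x₁≈ j = position-separates xs (listed x₁ (lift x₁∈ann)) (mono (suc zero) j)
    x₁≈0 : x₁ ≈ 0#
    x₁≈0 = x+x≈x⇒x≈0 x₁ (trans (+-congʳ (x₁≈ zero)) (trans x₀+x₁≈x₂ (sym (x₁≈ (suc (suc zero))))))
    x≈0 : ∀ j → x j ≈ 0#
    x≈0 j = trans (sym (x₁≈ j)) x₁≈0

module ColumnsCondition {c ℓ : Level} (R : CommutativeRing c ℓ) (b : CommutativeRing.Carrier R) where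
  open CommutativeRing R hiding (zero) renaming (Carrier to A)
  open RingDefs R
  open Basics R
  open import Relation.Binary.Reasoning.Setoid setoid

  DivisorCondition : Set (c ⊔ ℓ)
  DivisorCondition = Σ A λ d → d * b ≈ 0# × ((n : ℕ) → Infinite (principalIdeal (pow d n)))

  blockSum : ∀ {m} → (Fin 3 → Fin (suc m)) → Fin (suc m) → Fin 3 → A
  blockSum p t i = sumᶠ (λ j → when (p j ≟ᶠ t) (matB b i j))

  earlierSum : ∀ {m} → (Fin 3 → Fin (suc m)) → Fin (suc m) → (Fin 3 → A) → Fin 3 → A
  earlierSum p t λs i = sumᶠ (λ j → when (toℕ (p j) ℕ.<? toℕ t) (λs j * matB b i j))

  isolate : Fin 3 → Fin 3 → Fin 2
  isolate j j' with j' ≟ᶠ j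
  ... | yes _ = suc zero
  ... | no  _ = zero

  1-1≈0 : 1# + (- 1# + 0#) ≈ 0#
  1-1≈0 = trans (+-congˡ (+-identityʳ (- 1#))) (-‿inverseʳ 1#)

  -- (2 ⇐)  I₀ = {1,2}, I₁ = {0}, d₀ = d₁ = d and d c₀ = d c₁ (as d b = 0).
  divisor⇒gcc : DivisorCondition → GCC (matB b)
  divisor⇒gcc (d , db≈0 , powers-inf) =
    1 , isolate zero , (λ _ → d) , blocks , (λ _ → d≉0) , cond-i , cond-ii , cond-iii
    where
    d≉0 : ¬ d ≈ 0#
    d≉0 d≈0 = powers-inf 1 (zero-ideal-finite (trans (*-identityʳ d) d≈0))

    blocks : ∀ t → Σ (Fin 3) λ j → isolate zero j ≡ t
    blocks zero       = suc zero , P.refl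
    blocks (suc zero) = zero , P.refl

    cond-i : ∀ i → d * blockSum (isolate zero) zero i ≈ 0#
    cond-i zero = trans (*-congˡ (trans (+-identityˡ _) 1-1≈0)) (zeroʳ d)
    cond-i (suc zero)       = trans (*-congˡ (only-second refl refl)) db≈0
    cond-i (suc (suc zero)) = trans (*-congˡ (only-third refl refl)) db≈0

    λs : Fin 3 → A
    λs (suc zero) = d
    λs _          = 0#

    combination : ∀ i → d * blockSum (isolate zero) (suc zero) i
                          ≈ earlierSum (isolate zero) (suc zero) λs i
    combination zero = trans (*-congˡ (only-first refl refl)) (sym (only-second refl (zeroˡ (- 1#))))
    combination (suc zero) =
      trans (*-congˡ (all-vanish refl refl refl))
            (trans (zeroʳ d) (sym (all-vanish refl db≈0 (zeroˡ 0#))))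
    combination (suc (suc zero)) =
      trans (*-congˡ (all-vanish refl refl refl))
            (trans (zeroʳ d) (sym (all-vanish refl (zeroʳ d) (zeroˡ b))))

    cond-ii : ∀ t → 0 ℕ.< toℕ t → Σ (Fin 3 → A) λ λs → ∀ i →
                d * blockSum (isolate zero) t i ≈ earlierSum (isolate zero) t λs i
    cond-ii (suc zero) _ = λs , combination

    cond-iii : 0 ℕ.< 1 → ∀ n → Infinite (principalIdeal (d * pow (d * 1#) n))
    cond-iii _ n = infinite-⊇ (ideal-resp (*-congˡ (pow-cong (sym (*-identityʳ d)) n)))
                              (powers-inf (suc n))

  OddOneOut : (Fin 3 → Set) → Set
  OddOneOut P = Σ (Fin 3) λ j → ¬ P j × (∀ j' → j' ≢ j → P j')

  -- If a nonzero d annihilates the first row (1, 1, −1) summed over a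
  -- nonempty set I = {j : P j} of columns, then I has exactly two elements:
  -- every other nonempty I gives the sum 1 or −1, a unit.
  odd-column-out : ∀ {P : Fin 3 → Set} (δ : ∀ j → Dec (P j)) {d : A} → ¬ d ≈ 0# →
    Σ (Fin 3) P →
    d * (when (δ zero) 1# + (when (δ (suc zero)) 1# + (when (δ (suc (suc zero))) (- 1#) + 0#))) ≈ 0# →
    OddOneOut P
  odd-column-out {P} δ d≉0 (j₀ , Pj₀) I-ann with δ zero | δ (suc zero) | δ (suc (suc zero))
  ... | yes P₀ | yes P₁ | no ¬P₂ =
    suc (suc zero) , ¬P₂ , λ { zero _ → P₀ ; (suc zero) _ → P₁ ; (suc (suc zero)) ne → ⊥-elim (ne P.refl) }
  ... | yes P₀ | no ¬P₁ | yes P₂ =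
    suc zero , ¬P₁ , λ { zero _ → P₀ ; (suc zero) ne → ⊥-elim (ne P.refl) ; (suc (suc zero)) _ → P₂ }
  ... | no ¬P₀ | yes P₁ | yes P₂ =
    zero , ¬P₀ , λ { zero ne → ⊥-elim (ne P.refl) ; (suc zero) _ → P₁ ; (suc (suc zero)) _ → P₂ }
  ... | yes _ | yes _ | yes _ = ⊥-elim (d≉0 (annihilates-one I-ann (trans (+-congˡ 1-1≈0) (+-identityʳ 1#))))
  ... | yes _ | no  _ | no  _ = ⊥-elim (d≉0 (annihilates-one I-ann (only-first refl refl)))
  ... | no  _ | yes _ | no  _ = ⊥-elim (d≉0 (annihilates-one I-ann (only-second refl refl)))
  ... | no  _ | no  _ | yes _ = ⊥-elim (d≉0 (annihilates-minus-one I-ann (only-third refl refl)))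
  ... | no ¬P₀ | no ¬P₁ | no ¬P₂ = ⊥-elim (absent j₀ Pj₀)
    where
    absent : ∀ j → ¬ P j
    absent zero             = ¬P₀
    absent (suc zero)       = ¬P₁
    absent (suc (suc zero)) = ¬P₂

  later-block-is-odd : ∀ {m} {p : Fin 3 → Fin (suc m)} {t} (odd : OddOneOut (λ j → p j ≡ zero)) →
                       Σ (Fin 3) (λ j' → p j' ≡ suc t) → p (proj₁ odd) ≡ suc t
  later-block-is-odd (j , _ , others) (j' , pj'≡t+1) with j' ≟ᶠ j
  ... | yes P.refl = pj'≡t+1
  ... | no  j'≢j   = ⊥-elim (0≢1+n (P.trans (P.sym (others j' j'≢j)) pj'≡t+1))

  odd-partition : ∀ {p : Fin 3 → Fin 2} (odd : OddOneOut (λ j → p j ≡ zero)) →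
                  p (proj₁ odd) ≡ suc zero → ∀ j' → p j' ≡ isolate (proj₁ odd) j'
  odd-partition (j , _ , others) pj≡1 j' with j' ≟ᶠ j
  ... | yes P.refl = pj≡1
  ... | no  j'≢j   = others j' j'≢j

  -- If d₁ c_j is a combination of the other two columns then d₁ b = 0:
  -- for j = 1, 2 read off row j; for j = 0,  d₁ = λ₁ − λ₂  with λ₁, λ₂ ∈ ann(b).
  column-condition : ∀ j {d₁ : A} (λs : Fin 3 → A) →
    (∀ i → d₁ * blockSum (isolate j) (suc zero) i ≈ earlierSum (isolate j) (suc zero) λs i) →
    d₁ * b ≈ 0#
  column-condition zero {d₁} λs combination = begin
    d₁ * b          ≈⟨ *-congʳ d₁≈λ₁-λ₂ ⟩
    (λ₁ - λ₂) * b   ≈⟨ difference-annihilated λ₂b≈0 λ₁b≈0 ⟩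
    0#              ∎
    where
    λ₁ λ₂ : A
    λ₁ = λs (suc zero)
    λ₂ = λs (suc (suc zero))
    d₁c₀-vanishes : d₁ * (0# + (0# + (0# + 0#))) ≈ 0#
    d₁c₀-vanishes = trans (*-congˡ (all-vanish refl refl refl)) (zeroʳ d₁)
    λ₁b≈0 : λ₁ * b ≈ 0#
    λ₁b≈0 = trans (sym (only-second refl (zeroʳ λ₂)))
                  (trans (sym (combination (suc zero))) d₁c₀-vanishes)
    λ₂b≈0 : λ₂ * b ≈ 0#
    λ₂b≈0 = trans (sym (only-third refl (zeroʳ λ₁)))
                  (trans (sym (combination (suc (suc zero)))) d₁c₀-vanishes)
    d₁≈λ₁-λ₂ : d₁ ≈ λ₁ - λ₂
    d₁≈λ₁-λ₂ = begin
      d₁                                ≈⟨ *-identityʳ d₁ ⟨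
      d₁ * 1#                           ≈⟨ *-congˡ (only-first refl refl) ⟨
      d₁ * (1# + (0# + (0# + 0#)))      ≈⟨ combination zero ⟩
      0# + (λ₁ * 1# + (λ₂ * - 1# + 0#)) ≈⟨ +-identityˡ _ ⟩
      λ₁ * 1# + (λ₂ * - 1# + 0#)        ≈⟨ +-cong (*-identityʳ λ₁) (trans (+-identityʳ (λ₂ * - 1#))
                                             (trans (*-comm λ₂ (- 1#)) (-1*x≈-x λ₂))) ⟩
      λ₁ - λ₂                           ∎
  column-condition (suc zero) λs combination =
    trans (*-congˡ (sym (only-second refl refl)))
          (trans (combination (suc zero)) (all-vanish (zeroʳ _) refl (zeroʳ _)))
  column-condition (suc (suc zero)) λs combination =
    trans (*-congˡ (sym (only-third refl refl)))
          (trans (combination (suc (suc zero))) (all-vanish (zeroʳ _) (zeroʳ _) refl))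

  only-zero : (t : Fin 1) → t ≡ zero
  only-zero zero = P.refl

  gcc⇒divisor : GCC (matB b) → DivisorCondition
  gcc⇒divisor (zero , p , d , blocks , d≉0 , cond-i , _)
    with odd-column-out (λ j → p j ≟ᶠ zero) (d≉0 zero) (blocks zero) (cond-i zero)
  ... | j , pj≢0 , _ = ⊥-elim (pj≢0 (only-zero (p j)))
  gcc⇒divisor (suc (suc m) , p , d , blocks , d≉0 , cond-i , _) =
    ⊥-elim (0≢1+n (suc-injective (P.trans (P.sym (later-block-is-odd odd (blocks (suc zero))))
                                          (later-block-is-odd odd (blocks (suc (suc zero)))))))
    where
    odd : OddOneOut (λ j → p j ≡ zero)
    odd = odd-column-out (λ j → p j ≟ᶠ zero) (d≉0 zero) (blocks zero) (cond-i zero)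
  gcc⇒divisor (suc zero , p , d , blocks , d≉0 , cond-i , cond-ii , cond-iii) =
    d₁ , column-condition j λs combination , powers-inf
    where
    d₀ d₁ : A
    d₀ = d zero
    d₁ = d (suc zero)
    odd : OddOneOut (λ j → p j ≡ zero)
    odd = odd-column-out (λ j → p j ≟ᶠ zero) (d≉0 zero) (blocks zero) (cond-i zero)
    j : Fin 3
    j = proj₁ odd
    p≗isolate : ∀ j' → p j' ≡ isolate j j'
    p≗isolate = odd-partition odd (later-block-is-odd odd (blocks (suc zero)))
    λs : Fin 3 → A
    λs = proj₁ (cond-ii (suc zero) (s≤s z≤n))
    combination : ∀ i → d₁ * blockSum (isolate j) (suc zero) i
                          ≈ earlierSum (isolate j) (suc zero) λs i
    combination i = begin
      d₁ * blockSum (isolate j) (suc zero) i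
        ≈⟨ *-congˡ (sum-when-reindex (_≟ᶠ suc zero) p≗isolate (matB b i)) ⟨
      d₁ * blockSum p (suc zero) i
        ≈⟨ proj₂ (cond-ii (suc zero) (s≤s z≤n)) i ⟩
      earlierSum p (suc zero) λs i
        ≈⟨ sum-when-reindex (λ k → toℕ k ℕ.<? 1) p≗isolate (λ j' → λs j' * matB b i j') ⟩
      earlierSum (isolate j) (suc zero) λs i ∎
    powers-inf : ∀ n → Infinite (principalIdeal (pow d₁ n))
    powers-inf n = infinite-⊇ (ideal-⊆-multiple ∘ ideal-resp d₀d₁ⁿ≈d₁ⁿd₀) (cond-iii (s≤s z≤n) n)
      where
      d₀d₁ⁿ≈d₁ⁿd₀ : d₀ * pow (d₁ * 1#) n ≈ pow d₁ n * d₀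
      d₀d₁ⁿ≈d₁ⁿd₀ = trans (*-comm d₀ _) (*-congʳ (pow-cong (*-identityʳ d₁) n))

open CommutativeRing using (Carrier; _≈_; _*_; 0#)
open RingDefs using (PartitionRegular; GCC; matB; Infinite; ann; principalIdeal; pow)

lemma4p2 : ∀ {c ℓ} (R : CommutativeRing c ℓ) → ExcludedMiddle (c ⊔ ℓ) →
    (b : Carrier R) →
      (PartitionRegular R (matB R b) ⇔ Infinite R (ann R b))
      × (GCC R (matB R b) ⇔
           Σ (Carrier R) (λ d → _≈_ R (_*_ R d b) (0# R)
             × ((n : ℕ) → Infinite R (principalIdeal R (pow R d n)))))
lemma4p2 R lem b =
    mk⇔ regular⇒infinite infinite⇒regular
  , mk⇔ gcc⇒divisor divisor⇒gcc
  where
  open PartitionRegularity R lem b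
  open ColumnsCondition R b
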